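{- Let $Q$ be a quantale, $M$ a left $Q$-module, $\vartheta \subseteq M\times M$, $M_\vartheta$ the set of $\vartheta$-saturated elements of $M$, and $$\rho_\vartheta: v \in M \mapsto \bigwedge\{s \in M_\vartheta \mid v \leq s\} \in M.$$ Then $\rho_\vartheta$ is a $Q$-module nucleus whose image is $M_\vartheta$. Moreover, $M_\vartheta$, with the $Q$-module structure induced by $\rho_\vartheta$ (join ${}^{\rho}\bigvee X = \rho_\vartheta(\bigvee X)$, action $a\cdot_\rho u = \rho_\vartheta(au)$), is isomorphic to the quotient of $M$ by the $Q$-module congruence generated by $\vartheta$.
   Context: A (unital) quantale is a complete lattice with a monoid structure whose product distributes over arbitrary joins in each argument; a left $Q$-module is a complete lattice $M$ with an associative, unital action $Q\times M \to M$ distributing over arbitrary joins in both arguments. A $Q$-module nucleus on $M$ is a closure operator $\gamma$ on $M$ (monotone, extensive, idempotent) such that $a\gamma(u) \leq \gamma(au)$ for all $a\in Q$, $u \in M$. For $\vartheta \subseteq M \times M$, $s \in M$ is $\vartheta$-saturated if for all $(v,w) \in \vartheta$ and $a \in Q$: $a v \leq s \iff a w \leq s$. -}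

module Defs where

open import Level using (Level; suc)
open import Relation.Binary using (Rel; IsPartialOrder; IsEquivalence; _⇒_)
open import Relation.Unary using (Pred; _∈_)
open import Relation.Binary.PropositionalEquality using (_≡_)
open import Data.Product using (Σ; ∃; _×_; proj₁)

image : ∀ {ℓ} {A B : Set ℓ} → (A → B) → Pred A ℓ → Pred B ℓ
image f X = λ y → ∃ λ x → x ∈ X × f x ≡ y

range : ∀ {ℓ} {I A : Set ℓ} → (I → A) → Pred A ℓ
range x = λ m → ∃ λ i → x i ≡ m

record CompleteLattice (ℓ : Level) : Set (suc ℓ) where
  infix 4 _≤_
  field
    Carrier        : Set ℓ
    _≤_            : Rel Carrier ℓ
    isPartialOrder : IsPartialOrder _≡_ _≤_
    ⋁              : Pred Carrier ℓ → Carrier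
    ⋁-upper        : ∀ (X : Pred Carrier ℓ) {x} → x ∈ X → x ≤ ⋁ X
    ⋁-least        : ∀ (X : Pred Carrier ℓ) {y} → (∀ {x} → x ∈ X → x ≤ y) → ⋁ X ≤ y

  LowerBounds : Pred Carrier ℓ → Pred Carrier ℓ
  LowerBounds X = λ y → ∀ {x} → x ∈ X → y ≤ x

  ⋀ : Pred Carrier ℓ → Carrier
  ⋀ X = ⋁ (LowerBounds X)

record Quantale (ℓ : Level) : Set (suc ℓ) where
  field
    lattice : CompleteLattice ℓ
  open CompleteLattice lattice public
  infixl 7 _*_
  field
    _*_        : Carrier → Carrier → Carrier
    e          : Carrier
    *-assoc    : ∀ a b c → (a * b) * c ≡ a * (b * c)
    *-identityˡ : ∀ a → e * a ≡ a
    *-identityʳ : ∀ a → a * e ≡ a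
    *-distribˡ : ∀ a (X : Pred Carrier ℓ) → a * ⋁ X ≡ ⋁ (image (a *_) X)
    *-distribʳ : ∀ (X : Pred Carrier ℓ) a → ⋁ X * a ≡ ⋁ (image (_* a) X)

record LeftModule {ℓ : Level} (Q : Quantale ℓ) : Set (suc ℓ) where
  module Q = Quantale Q
  field
    lattice : CompleteLattice ℓ
  open CompleteLattice lattice public
  infixr 7 _·_
  field
    _·_        : Q.Carrier → Carrier → Carrier
    ·-assoc    : ∀ a b u → (a Q.* b) · u ≡ a · (b · u)
    ·-identity : ∀ u → Q.e · u ≡ u
    ·-distribˡ : ∀ a (X : Pred Carrier ℓ) → a · ⋁ X ≡ ⋁ (image (a ·_) X)
    ·-distribʳ : ∀ (X : Pred Q.Carrier ℓ) u → Q.⋁ X · u ≡ ⋁ (image (_· u) X)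

module _ {ℓ : Level} {Q : Quantale ℓ} (M : LeftModule Q) where
  open LeftModule M

  record IsModuleNucleus (γ : Carrier → Carrier) : Set ℓ where
    field
      monotone   : ∀ {u v} → u ≤ v → γ u ≤ γ v
      extensive  : ∀ u → u ≤ γ u
      idempotent : ∀ u → γ (γ u) ≡ γ u
      strength   : ∀ (a : Q.Carrier) u → a · γ u ≤ γ (a · u)

  Saturated : Rel Carrier ℓ → Carrier → Set ℓ
  Saturated ϑ s = ∀ {v w} → ϑ v w → ∀ (a : Q.Carrier) →
                  (a · v ≤ s → a · w ≤ s) × (a · w ≤ s → a · v ≤ s)

  Mϑ : Rel Carrier ℓ → Set ℓ
  Mϑ ϑ = Σ Carrier (Saturated ϑ)

  ρ : Rel Carrier ℓ → Carrier → Carrier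
  ρ ϑ v = ⋀ (λ s → Saturated ϑ s × v ≤ s)

  record IsCongruence (R : Rel Carrier ℓ) : Set (suc ℓ) where
    field
      isEquivalence : IsEquivalence R
      ⋁-cong : ∀ {I : Set ℓ} (x y : I → Carrier) → (∀ i → R (x i) (y i)) →
               R (⋁ (range x)) (⋁ (range y))
      ·-cong : ∀ (a : Q.Carrier) {u v} → R u v → R (a · u) (a · v)

  record IsGeneratedCongruence (ϑ R : Rel Carrier ℓ) : Set (suc ℓ) where
    field
      isCongruence : IsCongruence R
      contains     : ϑ ⇒ R
      least        : ∀ (R' : Rel Carrier ℓ) → IsCongruence R' → ϑ ⇒ R' → R ⇒ R'

  -- An isomorphism of Q-modules between M_ϑ (join ρ(⋁X), action ρ(a·u))
  -- and the quotient M/R (carrier M, equality R, join ⋁, action ·).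
  record QuotientIso (ϑ R : Rel Carrier ℓ) : Set (suc ℓ) where
    field
      f : Mϑ ϑ → Carrier
      g : Carrier → Mϑ ϑ
      f-cong  : ∀ (s t : Mϑ ϑ) → proj₁ s ≡ proj₁ t → R (f s) (f t)
      g-cong  : ∀ {u v} → R u v → proj₁ (g u) ≡ proj₁ (g v)
      g∘f     : ∀ (s : Mϑ ϑ) → proj₁ (g (f s)) ≡ proj₁ s
      f∘g     : ∀ u → R (f (g u)) u
      f-join  : ∀ (X : Pred (Mϑ ϑ) ℓ) (s : Mϑ ϑ) →
                proj₁ s ≡ ρ ϑ (⋁ (image proj₁ X)) → R (f s) (⋁ (image f X))
      f-act   : ∀ (a : Q.Carrier) (s t : Mϑ ϑ) →
                proj₁ t ≡ ρ ϑ (a · proj₁ s) → R (f t) (a · f s)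

-- The ϑ-saturated elements are closed under arbitrary meets, so ρ_ϑ is the
-- closure operator of this Moore family; it is a module nucleus because the
-- residual a ⊸ s = ⋁{x ∣ a·x ≤ s} of a saturated s is again saturated.
-- For the quotient: the kernel of any module nucleus is a congruence, and
-- the kernel of ρ_ϑ contains ϑ, so it contains the generated congruence R.
-- Conversely every R-class has a largest element, which is ϑ-saturated, and
-- ρ_ϑ(u) lies between u and it; since classes are convex, ρ_ϑ(u) R u.
-- Hence the inclusion M_ϑ → M and ρ_ϑ : M → M_ϑ are mutually inverse
-- modulo R, and they carry the induced structure to that of M/R.
module Submission where

open import Defs
open import Level using (Level; Lift; lift)
open import Relation.Binary using (Rel; IsPartialOrder; IsEquivalence; _⇒_)
open import Relation.Unary using (Pred; _∈_)
open import Relation.Binary.PropositionalEquality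
  using (_≡_; refl; sym; trans; subst; subst₂)
open import Data.Product using (Σ; ∃; _×_; _,_; proj₁; proj₂)
open import Data.Bool using (Bool; true; false; if_then_else_)

module CompleteLatticeProperties {ℓ : Level} (L : CompleteLattice ℓ) where
  open CompleteLattice L
  open IsPartialOrder isPartialOrder public
    using () renaming (refl to ≤-refl; trans to ≤-trans; antisym to ≤-antisym)

  ⋀-lower : ∀ (X : Pred Carrier ℓ) {x} → x ∈ X → ⋀ X ≤ x
  ⋀-lower X x∈X = ⋁-least (LowerBounds X) (λ y∈LB → y∈LB x∈X)

  ⋀-greatest : ∀ (X : Pred Carrier ℓ) {y} → (∀ {x} → x ∈ X → y ≤ x) → y ≤ ⋀ X
  ⋀-greatest X = ⋁-upper (LowerBounds X)

  ⋀-transfer : ∀ (X : Pred Carrier ℓ) {x y} →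
               (∀ {s} → s ∈ X → x ≤ s → y ≤ s) → x ≤ ⋀ X → y ≤ ⋀ X
  ⋀-transfer X h x≤⋀X = ⋀-greatest X (λ s∈X → h s∈X (≤-trans x≤⋀X (⋀-lower X s∈X)))

  ⋁-principal : ∀ y → ⋁ (_≤ y) ≡ y
  ⋁-principal y = ≤-antisym (⋁-least _ (λ x≤y → x≤y)) (⋁-upper _ ≤-refl)

  ⋁-const : ∀ {I : Set ℓ} {y} → I → ⋁ (range (λ (_ : I) → y)) ≡ y
  ⋁-const i = ≤-antisym (⋁-least _ (λ { (_ , refl) → ≤-refl })) (⋁-upper _ (i , refl))

  infixr 6 _∨_
  _∨_ : Carrier → Carrier → Carrier
  x ∨ y = ⋁ (range (λ (b : Lift ℓ Bool) → if Lift.lower b then x else y))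

  x≤x∨y : ∀ x y → x ≤ x ∨ y
  x≤x∨y x y = ⋁-upper _ (lift true , refl)

  y≤x∨y : ∀ x y → y ≤ x ∨ y
  y≤x∨y x y = ⋁-upper _ (lift false , refl)

  ∨-least : ∀ {x y z} → x ≤ z → y ≤ z → x ∨ y ≤ z
  ∨-least x≤z y≤z = ⋁-least _ λ { (lift true , refl) → x≤z ; (lift false , refl) → y≤z }

  x≤y⇒x∨y≡y : ∀ {x y} → x ≤ y → x ∨ y ≡ y
  x≤y⇒x∨y≡y {x} {y} x≤y = ≤-antisym (∨-least x≤y ≤-refl) (y≤x∨y x y)

  x≤y⇒y∨x≡y : ∀ {x y} → x ≤ y → y ∨ x ≡ y
  x≤y⇒y∨x≡y {x} {y} x≤y = ≤-antisym (∨-least ≤-refl x≤y) (x≤x∨y y x)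

module LeftModuleProperties {ℓ : Level} {Q : Quantale ℓ} (M : LeftModule Q) where
  open LeftModule M
  open CompleteLatticeProperties lattice public

  ·-monoʳ : ∀ a {x y} → x ≤ y → a · x ≤ a · y
  ·-monoʳ a {x} {y} x≤y = subst (λ z → a · x ≤ a · z) (⋁-principal y)
    (subst (a · x ≤_) (sym (·-distribˡ a (_≤ y))) (⋁-upper _ (x , x≤y , refl)))

  infixr 5 _⊸_
  _⊸_ : Q.Carrier → Carrier → Carrier
  a ⊸ s = ⋁ (λ x → a · x ≤ s)

  ⊸-intro : ∀ {a x s} → a · x ≤ s → x ≤ a ⊸ s
  ⊸-intro = ⋁-upper _

  ⊸-elim : ∀ {a x s} → x ≤ a ⊸ s → a · x ≤ s
  ⊸-elim {a} {x} {s} x≤a⊸s = ≤-trans (·-monoʳ a x≤a⊸s)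
    (subst (_≤ s) (sym (·-distribˡ a _)) (⋁-least _ (λ { (_ , a·y≤s , refl) → a·y≤s })))

  *·≤⇒≤⊸ : ∀ {a b u s} → (a Q.* b) · u ≤ s → b · u ≤ a ⊸ s
  *·≤⇒≤⊸ {a} {b} {u} {s} h = ⊸-intro (subst (_≤ s) (·-assoc a b u) h)

  ≤⊸⇒*·≤ : ∀ {a b u s} → b · u ≤ a ⊸ s → (a Q.* b) · u ≤ s
  ≤⊸⇒*·≤ {a} {b} {u} {s} h = subst (_≤ s) (sym (·-assoc a b u)) (⊸-elim h)

  module NucleusProperties {γ : Carrier → Carrier} (N : IsModuleNucleus M γ) where
    open IsModuleNucleus N

    ≤γ⇒γ≤γ : ∀ {u v} → u ≤ γ v → γ u ≤ γ v
    ≤γ⇒γ≤γ {u} {v} u≤γv = subst (γ u ≤_) (idempotent v) (monotone u≤γv)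

    kernel-isCongruence : IsCongruence M (λ u v → γ u ≡ γ v)
    kernel-isCongruence = record
      { isEquivalence = record { refl = refl ; sym = sym ; trans = trans }
      ; ⋁-cong = λ x y x~y → ≤-antisym (⋁-half x y x~y) (⋁-half y x (λ i → sym (x~y i)))
      ; ·-cong = λ a u~v → ≤-antisym (·-half a u~v) (·-half a (sym u~v))
      }
      where
      ⋁-half : ∀ {I : Set ℓ} (x y : I → Carrier) → (∀ i → γ (x i) ≡ γ (y i)) →
               γ (⋁ (range x)) ≤ γ (⋁ (range y))
      ⋁-half x y x~y = ≤γ⇒γ≤γ (⋁-least _ λ { (i , refl) →
        ≤-trans (extensive (x i))
          (subst (_≤ γ (⋁ (range y))) (sym (x~y i)) (monotone (⋁-upper _ (i , refl)))) })

      ·-half : ∀ a {u v} → γ u ≡ γ v → γ (a · u) ≤ γ (a · v)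
      ·-half a {u} {v} u~v = ≤γ⇒γ≤γ (≤-trans (·-monoʳ a (extensive u))
        (subst (λ z → a · z ≤ γ (a · v)) (sym u~v) (strength a v)))

  module CongruenceProperties {R : Rel Carrier ℓ} (C : IsCongruence M R) where
    open IsCongruence C
    open IsEquivalence isEquivalence public
      using (reflexive) renaming (refl to R-refl; sym to R-sym; trans to R-trans)

    ∨-cong : ∀ {x x′ y y′} → R x x′ → R y y′ → R (x ∨ y) (x′ ∨ y′)
    ∨-cong x~x′ y~y′ = ⋁-cong _ _ λ { (lift true) → x~x′ ; (lift false) → y~y′ }

    class-top : Carrier → Carrier
    class-top u = ⋁ (range {I = Σ Carrier (λ x → R x u)} proj₁)

    class-top-R : ∀ u → R (class-top u) u
    class-top-R u = subst (R (class-top u)) (⋁-const (u , R-refl)) (⋁-cong proj₁ _ proj₂)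

    R⇒≤class-top : ∀ {x u} → R x u → x ≤ class-top u
    R⇒≤class-top {x} x~u = ⋁-upper _ ((x , x~u) , refl)

    class-top-closed : ∀ {u p q} → R p q → p ≤ class-top u → q ≤ class-top u
    class-top-closed {u} {p} {q} p~q p≤top = ≤-trans (y≤x∨y (class-top u) q)
      (R⇒≤class-top (R-trans (∨-cong R-refl (R-sym p~q))
        (subst (λ z → R z u) (sym (x≤y⇒y∨x≡y p≤top)) (class-top-R u))))

    between⇒R : ∀ {u s} → u ≤ s → s ≤ class-top u → R s u
    between⇒R {u} u≤s s≤top = R-trans
      (subst₂ R (x≤y⇒x∨y≡y u≤s) (x≤y⇒y∨x≡y s≤top) (∨-cong (R-sym (class-top-R u)) R-refl))
      (class-top-R u)

module Saturation {ℓ : Level} {Q : Quantale ℓ} (M : LeftModule Q)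
                  (ϑ : Rel (LeftModule.Carrier M) ℓ) where
  open LeftModule M
  open LeftModuleProperties M

  ⋀-saturated : ∀ (X : Pred Carrier ℓ) → (∀ {s} → s ∈ X → Saturated M ϑ s) →
                Saturated M ϑ (⋀ X)
  ⋀-saturated X sat v~w a =
    ⋀-transfer X (λ s∈X → proj₁ (sat s∈X v~w a)) , ⋀-transfer X (λ s∈X → proj₂ (sat s∈X v~w a))

  ⊸-saturated : ∀ a {s} → Saturated M ϑ s → Saturated M ϑ (a ⊸ s)
  ⊸-saturated a sat v~w b =
      (λ h → *·≤⇒≤⊸ (proj₁ (sat v~w (a Q.* b)) (≤⊸⇒*·≤ h)))
    , (λ h → *·≤⇒≤⊸ (proj₂ (sat v~w (a Q.* b)) (≤⊸⇒*·≤ h)))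

  saturated-unit : ∀ {s v w} → Saturated M ϑ s → ϑ v w → (v ≤ s → w ≤ s) × (w ≤ s → v ≤ s)
  saturated-unit {s} sat v~w = unit (proj₁ (sat v~w Q.e)) , unit (proj₂ (sat v~w Q.e))
    where
    unit : ∀ {x y} → (Q.e · x ≤ s → Q.e · y ≤ s) → x ≤ s → y ≤ s
    unit {x} {y} h x≤s = subst (_≤ s) (·-identity y) (h (subst (_≤ s) (sym (·-identity x)) x≤s))

  ρ-saturated : ∀ v → Saturated M ϑ (ρ M ϑ v)
  ρ-saturated v = ⋀-saturated _ proj₁

  ρ-extensive : ∀ u → u ≤ ρ M ϑ u
  ρ-extensive u = ⋀-greatest _ proj₂

  ρ-least : ∀ {u s} → Saturated M ϑ s → u ≤ s → ρ M ϑ u ≤ s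
  ρ-least sat u≤s = ⋀-lower _ ((λ {v} {w} → sat {v} {w}) , u≤s)

  ρ-fixed : ∀ {s} → Saturated M ϑ s → ρ M ϑ s ≡ s
  ρ-fixed {s} sat = ≤-antisym (ρ-least sat ≤-refl) (ρ-extensive s)

  ρ-isModuleNucleus : IsModuleNucleus M (ρ M ϑ)
  ρ-isModuleNucleus = record
    { monotone   = λ {u} {v} u≤v → ρ-least (ρ-saturated v) (≤-trans u≤v (ρ-extensive v))
    ; extensive  = ρ-extensive
    ; idempotent = λ u → ρ-fixed (ρ-saturated u)
    ; strength   = λ a u → ⊸-elim (ρ-least (⊸-saturated a (ρ-saturated (a · u)))
                                            (⊸-intro (ρ-extensive (a · u))))
    }

  open NucleusProperties ρ-isModuleNucleus

  ϑ⊆kernel-ρ : ϑ ⇒ (λ u v → ρ M ϑ u ≡ ρ M ϑ v)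
  ϑ⊆kernel-ρ {v} {w} v~w = ≤-antisym
    (≤γ⇒γ≤γ (proj₂ (saturated-unit (ρ-saturated w) v~w) (ρ-extensive w)))
    (≤γ⇒γ≤γ (proj₁ (saturated-unit (ρ-saturated v) v~w) (ρ-extensive v)))

  module _ {R : Rel Carrier ℓ} (C : IsCongruence M R) (ϑ⊆R : ϑ ⇒ R) where
    open IsCongruence C using (·-cong)
    open CongruenceProperties C

    class-top-saturated : ∀ u → Saturated M ϑ (class-top u)
    class-top-saturated u v~w a =
      class-top-closed (·-cong a (ϑ⊆R v~w)) , class-top-closed (R-sym (·-cong a (ϑ⊆R v~w)))

    ρ-related : ∀ u → R (ρ M ϑ u) u
    ρ-related u = between⇒R (ρ-extensive u) (ρ-least (class-top-saturated u) (R⇒≤class-top R-refl))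

  quotientIso : ∀ {R} → IsGeneratedCongruence M ϑ R → QuotientIso M ϑ R
  quotientIso {R} G = record
    { f      = proj₁
    ; g      = λ u → ρ M ϑ u , ρ-saturated u
    ; f-cong = λ _ _ → reflexive
    ; g-cong = least _ kernel-isCongruence ϑ⊆kernel-ρ
    ; g∘f    = λ s → ρ-fixed (proj₂ s)
    ; f∘g    = ρu~u
    ; f-join = λ _ _ s≡ρ⋁ → R-trans (reflexive s≡ρ⋁) (ρu~u _)
    ; f-act  = λ _ _ _ t≡ρas → R-trans (reflexive t≡ρas) (ρu~u _)
    }
    where
    open IsGeneratedCongruence G
    open CongruenceProperties isCongruence using (reflexive; R-trans)
    ρu~u : ∀ u → R (ρ M ϑ u) u
    ρu~u = ρ-related isCongruence contains

theorem1p8 : ∀ {ℓ : Level} (Q : Quantale ℓ) (M : LeftModule Q)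
             (ϑ : Rel (LeftModule.Carrier M) ℓ) →
             IsModuleNucleus M (ρ M ϑ)
             × (∀ v → Saturated M ϑ (ρ M ϑ v))
             × (∀ s → Saturated M ϑ s → ∃ λ v → ρ M ϑ v ≡ s)
             × (∀ (R : Rel (LeftModule.Carrier M) ℓ) → IsGeneratedCongruence M ϑ R → QuotientIso M ϑ R)
theorem1p8 Q M ϑ =
  ρ-isModuleNucleus , ρ-saturated , (λ s sat → s , ρ-fixed sat) , (λ _ → quotientIso)
  where open Saturation M ϑ
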